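{- Let $d\ge3$, $\mathcal A=\{0,\dots,d-1\}$, $\varphi$ the morphism $\varphi(i)=0(i+1)$ ($0\le i\le d-2$), $\varphi(d-1)=0(d-1)(d-1)$, and $\mathbf u$ its fixed point. Then the letter $d-1$ is both a left and a right extension of every bispecial factor of $\mathbf u$, and $F_0,F_1,\dots,F_{d-3}$ are the only bispecial factors of $\mathbf u$ with more than two left extensions or more than two right extensions.
   Context: $\mathbf u$ is the unique infinite word starting with $0$ with $\varphi(\mathbf u)=\mathbf u$; $\mathcal L(\mathbf u)$ is its set of finite factors. A letter $a$ is a left (right) extension of $w$ if $aw\in\mathcal L(\mathbf u)$ ($wa\in\mathcal L(\mathbf u)$); $w$ is bispecial if it has at least two left and at least two right extensions. $F_0=\varepsilon$ and $F_k=\varphi(F_{k-1})0$ for $k=1,\dots,d-1$. -}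

module Defs where

open import Data.Nat using (ℕ; zero; suc; _+_; _∸_; _<?_)
open import Data.List using (List; []; _∷_; _++_; map; concatMap; upTo; length)
open import Data.Product using (Σ; ∃; _×_; _,_)
open import Relation.Nullary using (¬_; yes; no)
open import Relation.Binary.PropositionalEquality using (_≡_)

-- Letters of the alphabet A = {0,…,d-1} are represented by natural numbers
-- (only letters < d ever occur in u). Words are lists of letters.
Word : Set
Word = List ℕ

φ : ℕ → ℕ → Word
φ d i with suc i <? d
... | yes _ = 0 ∷ suc i ∷ []
... | no  _ = 0 ∷ (d ∸ 1) ∷ (d ∸ 1) ∷ []

φ* : ℕ → Word → Word
φ* d = concatMap (φ d)

iter : ℕ → ℕ → Word → Word
iter d zero    w = w
iter d (suc k) w = φ* d (iter d k w)

nth : Word → ℕ → ℕ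
nth []       _       = 0
nth (a ∷ w)  zero    = a
nth (a ∷ w)  (suc n) = nth w n

-- The fixed point u of φ starting with 0: its n-th letter is the n-th letter
-- of φ^(n+1)(0), which has length > n and is a prefix of u.
u : ℕ → ℕ → ℕ
u d n = nth (iter d (suc n) (0 ∷ [])) n

slice : ℕ → ℕ → ℕ → Word
slice d i n = map (λ j → u d (i + j)) (upTo n)

Factor : ℕ → Word → Set
Factor d w = ∃ λ i → w ≡ slice d i (length w)

LeftExt : ℕ → Word → ℕ → Set
LeftExt d w a = Factor d (a ∷ w)

RightExt : ℕ → Word → ℕ → Set
RightExt d w a = Factor d (w ++ a ∷ [])

TwoLeft : ℕ → Word → Set
TwoLeft d w = Σ ℕ λ a → Σ ℕ λ b → ¬ a ≡ b × LeftExt d w a × LeftExt d w b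

TwoRight : ℕ → Word → Set
TwoRight d w = Σ ℕ λ a → Σ ℕ λ b → ¬ a ≡ b × RightExt d w a × RightExt d w b

ThreeLeft : ℕ → Word → Set
ThreeLeft d w = Σ ℕ λ a → Σ ℕ λ b → Σ ℕ λ c →
  ¬ a ≡ b × ¬ a ≡ c × ¬ b ≡ c × LeftExt d w a × LeftExt d w b × LeftExt d w c

ThreeRight : ℕ → Word → Set
ThreeRight d w = Σ ℕ λ a → Σ ℕ λ b → Σ ℕ λ c →
  ¬ a ≡ b × ¬ a ≡ c × ¬ b ≡ c × RightExt d w a × RightExt d w b × RightExt d w c

Bispecial : ℕ → Word → Set
Bispecial d w = TwoLeft d w × TwoRight d w

F : ℕ → ℕ → Word
F d zero    = []
F d (suc k) = φ* d (F d k) ++ 0 ∷ []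

-- Write top = d - 1. In u, a letter other than 0 is always followed by 0, except inside the
-- block φ(top) = 0 top top, and 0 occurs only as the first letter of the blocks φ(i). Hence every
-- bispecial factor other than ε and top reads [top] φ(v) 0 [top] for a shorter bispecial factor v,
-- and its extensions are images of those of v under the letter ψ that ends (resp. follows 0 in) a
-- block; ψ fixes top. By induction on the length, a bispecial factor is either some F_k with
-- k ≤ d - 3, whose extension pairs are (k, > k), (> k, k) and (top, top), or all its left and all its
-- right extensions lie in sets of the form {x, top}. Either way top extends it on both sides, and
-- only the F_k can have three extensions on one side.
module Submission where

open import Defs
open import Data.Bool using (Bool; true; false)
open import Data.List using (List; []; _∷_; _++_; _∷ʳ_; length; applyUpTo; take; drop)
open import Data.List.Properties
  using (++-assoc; ++-identityʳ; ++-monoid; concatMap-++; ∷-injective; ∷-injectiveˡ; ∷-injectiveʳ;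
         ∷ʳ-++; ∷ʳ-injective; ∷ʳ-injectiveʳ; length-++; length-++-sucʳ; length-++-≤ˡ; length-++-≤ʳ;
         length-drop; take++drop≡id; map-applyUpTo)
open import Data.List.Relation.Unary.All as All using (All)
open import Data.List.Relation.Unary.All.Properties using (++⁺; ++⁻ˡ; ++⁻ʳ)
open import Data.Nat
open import Data.Nat.Induction using (<-wellFounded)
open import Data.Nat.Properties
open import Data.Product using (Σ; ∃; ∃₂; _×_; _,_; proj₂)
open import Data.Sum using (_⊎_; inj₁; inj₂)
open import Function.Base using (_∘_)
open import Function.Bundles using (_⇔_; mk⇔)
open import Induction.WellFounded using (Acc; acc)
open import Relation.Binary.PropositionalEquality
open import Relation.Nullary using (¬_; yes; no; contradiction)
open import Tactic.MonoidSolver using (solve)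

module _ {A : Set} where

  ++-split : ∀ (xs ys as bs : List A) → xs ++ ys ≡ as ++ bs →
    (∃ λ cs → as ≡ xs ++ cs × ys ≡ cs ++ bs) ⊎
    (∃₂ λ c cs → xs ≡ as ++ c ∷ cs × bs ≡ c ∷ cs ++ ys)
  ++-split []       ys as       bs eq = inj₁ (as , refl , eq)
  ++-split (x ∷ xs) ys []       bs eq = inj₂ (x , xs , refl , sym eq)
  ++-split (x ∷ xs) ys (a ∷ as) bs eq with ∷-injective eq
  ... | refl , eq′ with ++-split xs ys as bs eq′
  ...   | inj₁ (cs , e₁ , e₂)     = inj₁ (cs , cong (x ∷_) e₁ , e₂)
  ...   | inj₂ (c , cs , e₁ , e₂) = inj₂ (c , cs , cong (x ∷_) e₁ , e₂)

  Infix : List A → List A → Set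
  Infix w z = ∃₂ λ as bs → z ≡ as ++ w ++ bs

  infix-trans : ∀ {w z z′} → Infix w z → Infix z z′ → Infix w z′
  infix-trans {w} (as , bs , e) (as′ , bs′ , e′) =
    as′ ++ as , bs ++ bs′ , trans e′ (trans (cong (λ q → as′ ++ q ++ bs′) e) (regroup as′ as w bs bs′))
    where
    regroup : ∀ (as′ as w bs bs′ : List A) → as′ ++ (as ++ w ++ bs) ++ bs′ ≡ (as′ ++ as) ++ w ++ bs ++ bs′
    regroup as′ as w bs bs′ = solve (++-monoid A)

  ++-assoc₃ : ∀ (as bs cs ds : List A) → (as ++ bs ++ cs) ++ ds ≡ as ++ bs ++ cs ++ ds
  ++-assoc₃ as bs cs ds = solve (++-monoid A)

  ∷-unsnoc : ∀ (x : A) xs → ∃₂ λ ys y → x ∷ xs ≡ ys ∷ʳ y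
  ∷-unsnoc x []         = [] , x , refl
  ∷-unsnoc x (x′ ∷ xs) with ∷-unsnoc x′ xs
  ... | ys , y , e = x ∷ ys , y , cong (x ∷_) e

  ∷ʳ₂-injective : ∀ xs ys {x y x′ y′ : A} → xs ++ x ∷ y ∷ [] ≡ ys ++ x′ ∷ y′ ∷ [] →
    xs ∷ʳ x ≡ ys ∷ʳ x′ × y ≡ y′
  ∷ʳ₂-injective xs ys {x} {y} {x′} {y′} e =
    ∷ʳ-injective (xs ∷ʳ x) (ys ∷ʳ x′) (trans (∷ʳ-++ xs x (y ∷ [])) (trans e (sym (∷ʳ-++ ys x′ (y′ ∷ [])))))

  drop-length-++ : ∀ (as bs : List A) → drop (length as) (as ++ bs) ≡ bs
  drop-length-++ []       bs = refl
  drop-length-++ (a ∷ as) bs = drop-length-++ as bs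

  take-length-++ : ∀ (as bs : List A) → take (length as) (as ++ bs) ≡ as
  take-length-++ []       bs = refl
  take-length-++ (a ∷ as) bs = cong (a ∷_) (take-length-++ as bs)

  infix-middle : ∀ as w bs → Infix w (as ++ w ++ bs)
  infix-middle as w bs = as , bs , refl

  infix-prefix : ∀ w bs → Infix w (w ++ bs)
  infix-prefix w bs = [] , bs , refl

  infix-suffix : ∀ as w → Infix w (as ++ w)
  infix-suffix as w = as , [] , cong (as ++_) (sym (++-identityʳ w))

Two : (ℕ → Set) → Set
Two P = Σ ℕ λ a → Σ ℕ λ b → ¬ a ≡ b × P a × P b

Three : (ℕ → Set) → Set
Three P = Σ ℕ λ a → Σ ℕ λ b → Σ ℕ λ c → ¬ a ≡ b × ¬ a ≡ c × ¬ b ≡ c × P a × P b × P c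

module _ {P Q : ℕ → Set} (P⇒Q : ∀ {a} → P a → Q a) where

  Two-map : Two P → Two Q
  Two-map (a , b , a≢b , pa , pb) = a , b , a≢b , P⇒Q pa , P⇒Q pb

  Three-map : Three P → Three Q
  Three-map (a , b , c , a≢b , a≢c , b≢c , pa , pb , pc) =
    a , b , c , a≢b , a≢c , b≢c , P⇒Q pa , P⇒Q pb , P⇒Q pc

¬Two-unique : ∀ {P : ℕ → Set} z → (∀ a → P a → a ≡ z) → ¬ Two P
¬Two-unique z unique (a , b , a≢b , pa , pb) = a≢b (trans (unique a pa) (sym (unique b pb)))

nth-++ : ∀ xs ys {i} → i < length xs → nth (xs ++ ys) i ≡ nth xs i
nth-++ (x ∷ xs) ys {zero}  _         = refl
nth-++ (x ∷ xs) ys {suc i} (s≤s i<) = nth-++ xs ys i<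

nth-drop : ∀ i xs j → nth (drop i xs) j ≡ nth xs (i + j)
nth-drop zero    xs       j = refl
nth-drop (suc i) []       j = refl
nth-drop (suc i) (x ∷ xs) j = nth-drop i xs j

applyUpTo≡take : ∀ (f : ℕ → ℕ) k xs → k ≤ length xs → (∀ j → j < k → f j ≡ nth xs j) →
  applyUpTo f k ≡ take k xs
applyUpTo≡take f zero    xs       _         _ = refl
applyUpTo≡take f (suc k) (x ∷ xs) (s≤s k≤) h =
  cong₂ _∷_ (h 0 z<s) (applyUpTo≡take (f ∘ suc) k xs k≤ (λ j j< → h (suc j) (s≤s j<)))

module FixedPoint (m : ℕ) where

  -- The morphism φ and its blocks

  top : ℕ
  top = suc (suc m)

  d : ℕ
  d = suc top

  Φ : List ℕ → List ℕ
  Φ = φ* d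

  Φ-++ : ∀ xs ys → Φ (xs ++ ys) ≡ Φ xs ++ Φ ys
  Φ-++ = concatMap-++ (φ d)

  -- ψ a is both the second and the last letter of φ a.
  ψ : ℕ → ℕ
  ψ a with suc a <? d
  ... | yes _ = suc a
  ... | no  _ = top

  φ-short : ∀ {a} → suc a < d → φ d a ≡ 0 ∷ suc a ∷ []
  φ-short {a} a+1<d with suc a <? d
  ... | yes _     = refl
  ... | no a+1≮d = contradiction a+1<d a+1≮d

  ψ-short : ∀ {a} → suc a < d → ψ a ≡ suc a
  ψ-short {a} a+1<d with suc a <? d
  ... | yes _     = refl
  ... | no a+1≮d = contradiction a+1<d a+1≮d

  φ-long : ∀ {a} → ¬ suc a < d → φ d a ≡ 0 ∷ top ∷ top ∷ []
  φ-long {a} a+1≮d with suc a <? d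
  ... | yes a+1<d = contradiction a+1<d a+1≮d
  ... | no _      = refl

  ψ-long : ∀ {a} → ¬ suc a < d → ψ a ≡ top
  ψ-long {a} a+1≮d with suc a <? d
  ... | yes a+1<d = contradiction a+1<d a+1≮d
  ... | no _      = refl

  data Shape (a : ℕ) : Set where
    short : suc a < d → φ d a ≡ 0 ∷ suc a ∷ [] → ψ a ≡ suc a → Shape a
    long  : ¬ suc a < d → φ d a ≡ 0 ∷ top ∷ top ∷ [] → ψ a ≡ top → Shape a

  shape : ∀ a → Shape a
  shape a with suc a <? d
  ... | yes a+1<d = short a+1<d (φ-short a+1<d) (ψ-short a+1<d)
  ... | no a+1≮d  = long a+1≮d (φ-long a+1≮d) (ψ-long a+1≮d)

  ≮⇒≡top : ∀ {a} → a < d → ¬ suc a < d → a ≡ top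
  ≮⇒≡top a<d a+1≮d = ≤-antisym (s≤s⁻¹ a<d) (s≤s⁻¹ (≮⇒≥ a+1≮d))

  ψ-high : ∀ {a} → suc m ≤ a → a < d → ψ a ≡ top
  ψ-high {a} m<a a<d with shape a
  ... | short a+1<d _ ψa = trans ψa (cong suc (≤-antisym (s≤s⁻¹ (s≤s⁻¹ a+1<d)) m<a))
  ... | long _ _ ψa      = ψa

  ψ-top : ψ top ≡ top
  ψ-top = ψ-long (<-irrefl refl)

  φ-first : ∀ a → ∃ λ post → φ d a ≡ 0 ∷ ψ a ∷ post
  φ-first a with shape a
  ... | short _ e ψa = [] , trans e (cong (λ z → 0 ∷ z ∷ []) (sym ψa))
  ... | long  _ e ψa = top ∷ [] , trans e (cong (λ z → 0 ∷ z ∷ top ∷ []) (sym ψa))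

  φ-last : ∀ a → ∃ λ pre → φ d a ≡ pre ∷ʳ ψ a
  φ-last a with shape a
  ... | short _ e ψa = 0 ∷ [] , trans e (cong (λ z → 0 ∷ z ∷ []) (sym ψa))
  ... | long  _ e ψa = 0 ∷ top ∷ [] , trans e (cong (λ z → 0 ∷ top ∷ z ∷ []) (sym ψa))

  Φ-∷ : ∀ y Y → ∃₂ λ c R → Φ (y ∷ Y) ≡ 0 ∷ c ∷ R
  Φ-∷ y Y with shape y
  ... | short _ e _ = _ , _ , cong (_++ Φ Y) e
  ... | long  _ e _ = _ , _ , cong (_++ Φ Y) e

  Φ-head≡0 : ∀ Y {x xs} → Φ Y ≡ x ∷ xs → x ≡ 0
  Φ-head≡0 (y ∷ Y) e with Φ-∷ y Y
  ... | _ , _ , e′ = ∷-injectiveˡ (trans (sym e) e′)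

  Φ-++-0∷ : ∀ Y D → ∃ λ R → Φ Y ++ 0 ∷ D ≡ 0 ∷ R
  Φ-++-0∷ [] D = D , refl
  Φ-++-0∷ (y ∷ Y) D with Φ-∷ y Y
  ... | _ , _ , e = _ , cong (_++ 0 ∷ D) e

  Φ-∷ʳ : ∀ Y a → Φ (Y ∷ʳ a) ≡ Φ Y ++ φ d a
  Φ-∷ʳ Y a = trans (Φ-++ Y (a ∷ [])) (cong (Φ Y ++_) (++-identityʳ (φ d a)))

  length-≤-Φ : ∀ Y → length Y ≤ length (Φ Y)
  length-≤-Φ [] = z≤n
  length-≤-Φ (y ∷ Y) with shape y
  ... | short _ e _ rewrite e = s≤s (m≤n⇒m≤1+n (length-≤-Φ Y))
  ... | long  _ e _ rewrite e = s≤s (m≤n⇒m≤1+n (m≤n⇒m≤1+n (length-≤-Φ Y)))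

  Φ-letters : ∀ Y → All (_< d) (Φ Y)
  Φ-letters [] = All.[]
  Φ-letters (y ∷ Y) = ++⁺ (φ-letters y) (Φ-letters Y)
    where
    φ-letters : ∀ a → All (_< d) (φ d a)
    φ-letters a with shape a
    ... | short a+1<d e _ rewrite e = z<s All.∷ a+1<d All.∷ All.[]
    ... | long _ e _      rewrite e = z<s All.∷ ≤-refl All.∷ ≤-refl All.∷ All.[]

  φ-0-only-first : ∀ y c C r → ¬ φ d y ≡ c ∷ C ++ 0 ∷ r
  φ-0-only-first y c C r e with shape y
  ... | short _ e′ _ = short-case C (trans (sym e′) e)
    where
    short-case : ∀ C → ¬ 0 ∷ suc y ∷ [] ≡ c ∷ C ++ 0 ∷ r
    short-case [] ()
    short-case (_ ∷ []) ()
    short-case (_ ∷ _ ∷ _) ()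
  ... | long _ e′ _ = long-case C (trans (sym e′) e)
    where
    long-case : ∀ C → ¬ 0 ∷ top ∷ top ∷ [] ≡ c ∷ C ++ 0 ∷ r
    long-case [] ()
    long-case (_ ∷ []) ()
    long-case (_ ∷ _ ∷ []) ()
    long-case (_ ∷ _ ∷ _ ∷ _) ()

  -- Since 0 occurs in φ-blocks only in first position, an image is cut at a 0 only between blocks.
  Φ-cut-at-0 : ∀ Y C D → Φ Y ≡ C ++ 0 ∷ D →
    ∃₂ λ Y₁ Y₂ → Y ≡ Y₁ ++ Y₂ × Φ Y₁ ≡ C × Φ Y₂ ≡ 0 ∷ D
  Φ-cut-at-0 [] [] D ()
  Φ-cut-at-0 [] (_ ∷ _) D ()
  Φ-cut-at-0 (y ∷ Y) C D eq with ++-split (φ d y) (Φ Y) C (0 ∷ D) eq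
  ... | inj₁ (C′ , e₁ , e₂) with Φ-cut-at-0 Y C′ D e₂
  ...   | Y₁ , Y₂ , f₁ , f₂ , f₃ =
    y ∷ Y₁ , Y₂ , cong (y ∷_) f₁ , trans (cong (φ d y ++_) f₂) (sym e₁) , f₃
  Φ-cut-at-0 (y ∷ Y) [] D eq | inj₂ _ = [] , y ∷ Y , refl , refl , eq
  Φ-cut-at-0 (y ∷ Y) (c ∷ C) D eq | inj₂ (x , r , e₁ , e₂) with ∷-injectiveˡ e₂
  ... | refl = contradiction e₁ (φ-0-only-first y c C r)

  Φ-cancel-prefix : ∀ v Y D → All (_< d) v → All (_< d) Y → Φ Y ≡ Φ v ++ 0 ∷ D →
    ∃ λ Y′ → Y ≡ v ++ Y′ × Φ Y′ ≡ 0 ∷ D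
  Φ-cancel-prefix [] Y D _ _ eq = Y , refl , eq
  Φ-cancel-prefix (a ∷ v) [] D _ _ eq = contradiction (trans eq (proj₂ (Φ-++-0∷ (a ∷ v) D))) λ ()
  Φ-cancel-prefix (a ∷ v) (y ∷ Y) D (a<d All.∷ v<d) (y<d All.∷ Y<d) eq = step (shape a) (shape y)
    where
    blocks : ∀ {p q} → φ d y ≡ p → φ d a ≡ q → p ++ Φ Y ≡ q ++ Φ v ++ 0 ∷ D
    blocks refl refl = trans eq (++-assoc (φ d a) (Φ v) (0 ∷ D))

    next : y ≡ a → Φ Y ≡ Φ v ++ 0 ∷ D → ∃ λ Y′ → y ∷ Y ≡ (a ∷ v) ++ Y′ × Φ Y′ ≡ 0 ∷ D
    next refl e with Φ-cancel-prefix v Y D v<d Y<d e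
    ... | Y′ , f , g = Y′ , cong (y ∷_) f , g

    step : Shape a → Shape y → ∃ λ Y′ → y ∷ Y ≡ (a ∷ v) ++ Y′ × Φ Y′ ≡ 0 ∷ D
    step (short _ ea _) (short _ ey _) with ∷-injective (∷-injectiveʳ (blocks ey ea))
    ... | y+1≡a+1 , e = next (suc-injective y+1≡a+1) e
    step (long a+1≮d ea _) (long y+1≮d ey _) =
      next (trans (≮⇒≡top y<d y+1≮d) (sym (≮⇒≡top a<d a+1≮d)))
           (∷-injectiveʳ (∷-injectiveʳ (∷-injectiveʳ (blocks ey ea))))
    step (short _ ea _) (long _ ey _) =
      contradiction (∷-injectiveˡ (trans (∷-injectiveʳ (∷-injectiveʳ (blocks ey ea))) (proj₂ (Φ-++-0∷ v D)))) λ ()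
    step (long _ ea _) (short _ ey _) =
      contradiction (Φ-head≡0 Y (∷-injectiveʳ (∷-injectiveʳ (blocks ey ea)))) λ ()

  Φ-locate : ∀ Y A s S → Φ Y ≡ A ++ s ∷ S →
    ∃₂ λ y Y′ → ∃₂ λ pre x → ∃ λ r → φ d y ≡ pre ++ x ∷ r × s ∷ S ≡ x ∷ r ++ Φ Y′
  Φ-locate [] [] s S ()
  Φ-locate [] (_ ∷ _) s S ()
  Φ-locate (y ∷ Y) A s S eq with ++-split (φ d y) (Φ Y) A (s ∷ S) eq
  ... | inj₁ (A′ , _ , e) = Φ-locate Y A′ s S e
  ... | inj₂ (x , r , e₁ , e₂) = y , Y , A , x , r , e₁ , e₂

  -- Factors of u

  X : ℕ → List ℕ
  X K = iter d K (0 ∷ [])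

  iter-Φ : ∀ k w → iter d k (Φ w) ≡ Φ (iter d k w)
  iter-Φ zero    w = refl
  iter-Φ (suc k) w = cong Φ (iter-Φ k w)

  iter-++ : ∀ k xs ys → iter d k (xs ++ ys) ≡ iter d k xs ++ iter d k ys
  iter-++ zero    xs ys = refl
  iter-++ (suc k) xs ys = trans (cong Φ (iter-++ k xs ys)) (Φ-++ (iter d k xs) (iter d k ys))

  X-1 : X 1 ≡ 0 ∷ 1 ∷ []
  X-1 = cong (_++ []) (φ-short (s≤s (s≤s z≤n)))

  X-2 : X 2 ≡ 0 ∷ 1 ∷ 0 ∷ 2 ∷ []
  X-2 = trans (cong Φ X-1)
              (cong₂ (λ p q → p ++ q ++ []) (φ-short (s≤s (s≤s z≤n))) (φ-short (s≤s (s≤s (s≤s z≤n)))))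

  X-step : ∀ K → ∃₂ λ c C → X (suc K) ≡ X K ++ c ∷ C
  X-step zero = 1 , [] , X-1
  X-step (suc K) with X-step K
  ... | c , C , e with Φ-∷ c C
  ...   | c′ , R , e′ = 0 , c′ ∷ R , trans (cong Φ e) (trans (Φ-++ (X K) (c ∷ C)) (cong (Φ (X K) ++_) e′))

  X-∷ : ∀ K → ∃ λ xs → X K ≡ 0 ∷ xs
  X-∷ zero = [] , refl
  X-∷ (suc K) with X-∷ K
  ... | xs , e with Φ-∷ 0 xs
  ...   | c , R , e′ = c ∷ R , trans (cong Φ e) e′

  X-twice : ∀ K → X (suc (suc K)) ≡ X K ++ iter d K (1 ∷ []) ++ X K ++ iter d K (2 ∷ [])
  X-twice K = begin
    Φ (Φ (iter d K (0 ∷ [])))                                 ≡⟨ cong Φ (iter-Φ K (0 ∷ [])) ⟨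
    Φ (iter d K (Φ (0 ∷ [])))                                 ≡⟨ iter-Φ K (Φ (0 ∷ [])) ⟨
    iter d K (X 2)                                            ≡⟨ cong (iter d K) X-2 ⟩
    iter d K ((0 ∷ []) ++ (1 ∷ []) ++ (0 ∷ []) ++ (2 ∷ []))   ≡⟨ iter-++ K (0 ∷ []) _ ⟩
    X K ++ iter d K ((1 ∷ []) ++ (0 ∷ []) ++ (2 ∷ []))        ≡⟨ cong (X K ++_) (iter-++ K (1 ∷ []) _) ⟩
    X K ++ iter d K (1 ∷ []) ++ iter d K ((0 ∷ []) ++ (2 ∷ []))
      ≡⟨ cong (λ q → X K ++ iter d K (1 ∷ []) ++ q) (iter-++ K (0 ∷ []) (2 ∷ [])) ⟩
    X K ++ iter d K (1 ∷ []) ++ X K ++ iter d K (2 ∷ [])      ∎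
    where open ≡-Reasoning

  X-prefix : ∀ {K} K′ → K ≤ K′ → ∃ λ C → X K′ ≡ X K ++ C
  X-prefix {K} K′ K≤K′ with m≤n⇒m<n∨m≡n K≤K′
  ... | inj₂ refl = [] , sym (++-identityʳ (X K))
  X-prefix {K} (suc K′) _ | inj₁ (s≤s K≤K′) with X-prefix K′ K≤K′ | X-step K′
  ... | C , e | c , C′ , e′ =
    C ++ c ∷ C′ , trans e′ (trans (cong (_++ c ∷ C′) e) (++-assoc (X K) C (c ∷ C′)))

  X-length : ∀ K → K < length (X K)
  X-length zero = z<s
  X-length (suc K) with X-step K
  ... | c , C , e = subst (λ xs → suc K < length xs) (sym e)
    (subst (suc K <_) (sym (length-++-sucʳ (X K) c C)) (s≤s (≤-trans (X-length K) (length-++-≤ˡ (X K)))))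

  X-letters : ∀ K → All (_< d) (X K)
  X-letters zero    = z<s All.∷ All.[]
  X-letters (suc K) = Φ-letters (X K)

  -- X K and X (suc i) are both prefixes of X (K ⊔ suc i), and u d i is read off the latter.
  nth-X : ∀ K {i} → i < length (X K) → nth (X K) i ≡ u d i
  nth-X K {i} i< with X-prefix (K ⊔ suc i) (m≤m⊔n K (suc i)) | X-prefix (K ⊔ suc i) (m≤n⊔m K (suc i))
  ... | C , e | C′ , e′ = begin
    nth (X K) i                ≡⟨ nth-++ (X K) C i< ⟨
    nth (X K ++ C) i           ≡⟨ cong (λ xs → nth xs i) (trans (sym e) e′) ⟩
    nth (X (suc i) ++ C′) i    ≡⟨ nth-++ (X (suc i)) C′ (<-trans (n<1+n i) (X-length (suc i))) ⟩
    nth (X (suc i)) i          ∎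
    where open ≡-Reasoning

  slice-X : ∀ K i k → i + k ≤ length (X K) → slice d i k ≡ take k (drop i (X K))
  slice-X K i k i+k≤ = trans (map-applyUpTo (λ j → j) (λ j → u d (i + j)) k)
    (applyUpTo≡take _ k (drop i (X K))
      (subst (k ≤_) (sym (length-drop i (X K))) (m+n≤o⇒m≤o∸n k (subst (_≤ length (X K)) (+-comm i k) i+k≤)))
      (λ j j<k → trans (sym (nth-X K (<-≤-trans (+-monoʳ-< i j<k) i+k≤))) (sym (nth-drop i (X K) j))))

  infix-X-suc : ∀ {w} K → Infix w (X K) → Infix w (X (suc K))
  infix-X-suc K i with X-step K
  ... | c , C , e = subst (Infix _) (sym e) (infix-trans i (infix-prefix (X K) (c ∷ C)))

  opaque
    -- Factors as infixes of the prefixes φ^K(0) of u: closed under φ and infixes by construction.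
    Fac : List ℕ → Set
    Fac w = ∃ λ K → Infix w (X K)

  opaque
    unfolding Fac

    Fac-X : ∀ K → Fac (X K)
    Fac-X K = K , [] , [] , sym (++-identityʳ (X K))

    Fac⇒Factor : ∀ {w} → Fac w → Factor d w
    Fac⇒Factor {w} (K , as , bs , e) = length as , sym (begin
      slice d (length as) (length w)                          ≡⟨ slice-X K (length as) (length w) within ⟩
      take (length w) (drop (length as) (X K))                ≡⟨ cong (take (length w) ∘ drop (length as)) e ⟩
      take (length w) (drop (length as) (as ++ w ++ bs))      ≡⟨ cong (take (length w)) (drop-length-++ as (w ++ bs)) ⟩
      take (length w) (w ++ bs)                               ≡⟨ take-length-++ w bs ⟩
      w                                                       ∎)
      where
      open ≡-Reasoning
      within : length as + length w ≤ length (X K)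
      within = subst (λ xs → length as + length w ≤ length xs) (sym e)
        (subst (length as + length w ≤_) (sym (length-++ as))
          (+-monoʳ-≤ (length as) (length-++-≤ˡ w)))

    Factor⇒Fac : ∀ {w} → Factor d w → Fac w
    Factor⇒Fac {w} (i , e) = K , take i (X K) , drop (length w) (drop i (X K)) , sym (begin
      take i (X K) ++ w ++ rest                               ≡⟨ cong (λ z → take i (X K) ++ z ++ rest) w≡ ⟩
      take i (X K) ++ take (length w) (drop i (X K)) ++ rest
        ≡⟨ cong (take i (X K) ++_) (take++drop≡id (length w) (drop i (X K))) ⟩
      take i (X K) ++ drop i (X K)                            ≡⟨ take++drop≡id i (X K) ⟩
      X K                                                     ∎)
      where
      open ≡-Reasoning
      K : ℕ
      K = i + length w
      rest : List ℕ
      rest = drop (length w) (drop i (X K))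
      w≡ : w ≡ take (length w) (drop i (X K))
      w≡ = trans e (slice-X K i (length w) (<⇒≤ (X-length K)))

    Fac-infix : ∀ {w z} → Infix w z → Fac z → Fac w
    Fac-infix i (K , j) = K , infix-trans i j

    Fac-letters : ∀ {w} → Fac w → All (_< d) w
    Fac-letters {w} (K , as , bs , e) = ++⁻ˡ w (++⁻ʳ as (subst (All (_< d)) e (X-letters K)))

    Fac-Φ : ∀ {w} → Fac w → Fac (Φ w)
    Fac-Φ {w} (K , as , bs , e) = suc K , Φ as , Φ bs ,
      trans (cong Φ e) (trans (Φ-++ as (w ++ bs)) (cong (Φ as ++_) (Φ-++ w bs)))

    Fac-right : ∀ {w} → Fac w → ∃ λ b → Fac (w ++ b ∷ [])
    Fac-right {w} (K , as , bs , e) with X-step K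
    ... | c , C , e′ = extend bs (trans e′ (trans (cong (_++ c ∷ C) e) (++-assoc₃ as w bs (c ∷ C))))
      where
      extend : ∀ bs → X (suc K) ≡ as ++ w ++ bs ++ c ∷ C → ∃ λ b → Fac (w ++ b ∷ [])
      extend []        q = c , suc K , as , C , trans q (cong (as ++_) (sym (++-assoc w (c ∷ []) C)))
      extend (b ∷ bs′) q = b , suc K , as , bs′ ++ c ∷ C , trans q (cong (as ++_) (sym (++-assoc w (b ∷ []) _)))

    -- The second copy of X K inside X (K + 2) is preceded by a nonempty word.
    Fac-left : ∀ {w} → Fac w → ∃ λ a → Fac (a ∷ w)
    Fac-left {w} (K , as , bs , e) with X-∷ K
    ... | xs , e₀ with ∷-unsnoc 0 (xs ++ iter d K (1 ∷ []) ++ as)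
    ...   | ys , a , e₁ = a , suc (suc K) , ys , bs ++ I₂ , (begin
      X (suc (suc K))                         ≡⟨ X-twice K ⟩
      X K ++ I₁ ++ X K ++ I₂                  ≡⟨ cong (λ z → X K ++ I₁ ++ z ++ I₂) e ⟩
      X K ++ I₁ ++ (as ++ w ++ bs) ++ I₂      ≡⟨ cong (λ z → X K ++ I₁ ++ z) (++-assoc₃ as w bs I₂) ⟩
      X K ++ I₁ ++ as ++ w ++ bs ++ I₂        ≡⟨ ++-assoc₃ (X K) I₁ as (w ++ bs ++ I₂) ⟨
      (X K ++ I₁ ++ as) ++ w ++ bs ++ I₂      ≡⟨ cong (λ z → (z ++ I₁ ++ as) ++ w ++ bs ++ I₂) e₀ ⟩
      (0 ∷ xs ++ I₁ ++ as) ++ w ++ bs ++ I₂   ≡⟨ cong (_++ w ++ bs ++ I₂) e₁ ⟩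
      (ys ∷ʳ a) ++ w ++ bs ++ I₂              ≡⟨ ∷ʳ-++ ys a (w ++ bs ++ I₂) ⟩
      ys ++ (a ∷ w) ++ bs ++ I₂               ∎)
      where
      open ≡-Reasoning
      I₁ I₂ : List ℕ
      I₁ = iter d K (1 ∷ [])
      I₂ = iter d K (2 ∷ [])

  -- Two- and three-letter factors

  -- The extension pairs of F_k (F-exts); for k = 0 they comprise all two-letter factors (Fac-pair).
  FPair : ℕ → ℕ → ℕ → Set
  FPair k a b = (a ≡ k × k < b) ⊎ (k < a × b ≡ k) ⊎ (a ≡ top × b ≡ top)

  pair-in-short : ∀ Y′ {s a b bs} pre {x r} → 0 < s → 0 ∷ s ∷ [] ≡ pre ++ x ∷ r →
    a ∷ b ∷ bs ≡ x ∷ r ++ Φ Y′ → FPair 0 a b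
  pair-in-short Y′ []            0<s refl refl = inj₁ (refl , 0<s)
  pair-in-short Y′ (_ ∷ [])      0<s refl e    =
    inj₂ (inj₁ (subst (0 <_) (sym (∷-injectiveˡ e)) 0<s , Φ-head≡0 Y′ (sym (∷-injectiveʳ e))))
  pair-in-short Y′ (_ ∷ _ ∷ [])  0<s () _
  pair-in-short Y′ (_ ∷ _ ∷ _ ∷ _) 0<s () _

  pair-in-long : ∀ Y′ {a b bs} pre {x r} → 0 ∷ top ∷ top ∷ [] ≡ pre ++ x ∷ r →
    a ∷ b ∷ bs ≡ x ∷ r ++ Φ Y′ → FPair 0 a b
  pair-in-long Y′ []                refl refl = inj₁ (refl , z<s)
  pair-in-long Y′ (_ ∷ [])          refl refl = inj₂ (inj₂ (refl , refl))
  pair-in-long Y′ (_ ∷ _ ∷ [])      refl e    =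
    inj₂ (inj₁ (subst (0 <_) (sym (∷-injectiveˡ e)) z<s , Φ-head≡0 Y′ (sym (∷-injectiveʳ e))))
  pair-in-long Y′ (_ ∷ _ ∷ _ ∷ [])  () _
  pair-in-long Y′ (_ ∷ _ ∷ _ ∷ _ ∷ _) () _

  Has0 : ℕ → ℕ → ℕ → Set
  Has0 a b c = a ≡ 0 ⊎ b ≡ 0 ⊎ c ≡ 0

  triple-in-short : ∀ Y′ {s a b c bs} pre {x r} → 0 ∷ s ∷ [] ≡ pre ++ x ∷ r →
    a ∷ b ∷ c ∷ bs ≡ x ∷ r ++ Φ Y′ → Has0 a b c
  triple-in-short Y′ []              refl e    = inj₁ (∷-injectiveˡ e)
  triple-in-short Y′ (_ ∷ [])        refl e    = inj₂ (inj₁ (Φ-head≡0 Y′ (sym (∷-injectiveʳ e))))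
  triple-in-short Y′ (_ ∷ _ ∷ [])    () _
  triple-in-short Y′ (_ ∷ _ ∷ _ ∷ _) () _

  triple-in-long : ∀ Y′ {a b c bs} pre {x r} → 0 ∷ top ∷ top ∷ [] ≡ pre ++ x ∷ r →
    a ∷ b ∷ c ∷ bs ≡ x ∷ r ++ Φ Y′ → Has0 a b c
  triple-in-long Y′ []                  refl refl = inj₁ refl
  triple-in-long Y′ (_ ∷ [])            refl e    =
    inj₂ (inj₂ (Φ-head≡0 Y′ (sym (∷-injectiveʳ (∷-injectiveʳ e)))))
  triple-in-long Y′ (_ ∷ _ ∷ [])        refl e    = inj₂ (inj₁ (Φ-head≡0 Y′ (sym (∷-injectiveʳ e))))
  triple-in-long Y′ (_ ∷ _ ∷ _ ∷ [])    () _
  triple-in-long Y′ (_ ∷ _ ∷ _ ∷ _ ∷ _) () _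

  Φ-pair : ∀ Y as {a b bs} → Φ Y ≡ as ++ a ∷ b ∷ bs → FPair 0 a b
  Φ-pair Y as {a} {b} {bs} e with Φ-locate Y as a (b ∷ bs) e
  ... | y , Y′ , pre , _ , _ , e₁ , e₂ with shape y
  ...   | short _ ey _ = pair-in-short Y′ pre z<s (trans (sym ey) e₁) e₂
  ...   | long  _ ey _ = pair-in-long Y′ pre (trans (sym ey) e₁) e₂

  Φ-triple : ∀ Y as {a b c bs} → Φ Y ≡ as ++ a ∷ b ∷ c ∷ bs → Has0 a b c
  Φ-triple Y as {a} {b} {c} {bs} e with Φ-locate Y as a (b ∷ c ∷ bs) e
  ... | y , Y′ , pre , _ , _ , e₁ , e₂ with shape y
  ...   | short _ ey _ = triple-in-short Y′ pre (trans (sym ey) e₁) e₂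
  ...   | long  _ ey _ = triple-in-long Y′ pre (trans (sym ey) e₁) e₂

  opaque
    unfolding Fac

    Fac-pair : ∀ {a b} → Fac (a ∷ b ∷ []) → FPair 0 a b
    Fac-pair (K , occ) = let as , _ , e = infix-X-suc K occ in Φ-pair (X K) as e

    Fac-triple : ∀ {a b c} → Fac (a ∷ b ∷ c ∷ []) → Has0 a b c
    Fac-triple (K , occ) = let as , _ , e = infix-X-suc K occ in Φ-triple (X K) as e

  -- Desubstitution

  topIf : Bool → List ℕ
  topIf false = []
  topIf true  = top ∷ []

  wrap : Bool → List ℕ → Bool → List ℕ
  wrap p v t = topIf p ++ Φ v ++ 0 ∷ topIf t

  -- How an extension a of wrap p v t arises from an extension a′ of v: with p = false, a ends φ(a′);
  -- with p = true, φ(a′) must end with a top, which forces a′ ∈ {d - 2, top}.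
  Lifted : Bool → ℕ → ℕ → Set
  Lifted false a a′ = a ≡ ψ a′
  Lifted true  a a′ = (a′ ≡ suc m × a ≡ 0) ⊎ (a′ ≡ top × a ≡ top)

  right-lifted : ∀ t Y b B → All (_< d) Y → Φ Y ≡ 0 ∷ topIf t ++ b ∷ B →
    ∃₂ λ b′ Y′ → Y ≡ b′ ∷ Y′ × Lifted t b b′
  right-lifted false (b′ ∷ Y′) b B _ e with φ-first b′
  ... | post , e′ = b′ , Y′ , refl , ∷-injectiveˡ (∷-injectiveʳ (trans (sym e) (cong (_++ Φ Y′) e′)))
  right-lifted true (b′ ∷ Y′) b B (b′<d All.∷ _) e with shape b′
  ... | short _ e′ _ with ∷-injective (∷-injectiveʳ (trans (sym e) (cong (_++ Φ Y′) e′)))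
  ...   | b′+1≡top , e″ = b′ , Y′ , refl , inj₁ (suc-injective (sym b′+1≡top) , Φ-head≡0 Y′ (sym e″))
  right-lifted true (b′ ∷ Y′) b B (b′<d All.∷ _) e | long b′+1≮d e′ _ =
    b′ , Y′ , refl ,
    inj₂ (≮⇒≡top b′<d b′+1≮d , ∷-injectiveˡ (∷-injectiveʳ (∷-injectiveʳ (trans (sym e) (cong (_++ Φ Y′) e′)))))

  φ-end-lifted : ∀ p a′ {a} P A → a′ < d → P ++ φ d a′ ≡ A ++ a ∷ topIf p → Lifted p a a′
  φ-end-lifted false a′ P A _ e with φ-last a′
  ... | pre , e′ = ∷ʳ-injectiveʳ A (P ++ pre)
    (trans (sym e) (trans (cong (P ++_) e′) (sym (++-assoc P pre (ψ a′ ∷ [])))))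
  φ-end-lifted true a′ P A a′<d e with shape a′
  ... | short _ e′ _ with ∷ʳ₂-injective P A (trans (cong (P ++_) (sym e′)) e)
  ...   | e₀ , a′+1≡top = inj₁ (suc-injective a′+1≡top , sym (∷ʳ-injectiveʳ P A e₀))
  φ-end-lifted true a′ P A a′<d e | long a′+1≮d e′ _ with ∷ʳ₂-injective (P ∷ʳ 0) A
    (trans (∷ʳ-++ P 0 (top ∷ top ∷ [])) (trans (cong (P ++_) (sym e′)) e))
  ... | e₀ , _ = inj₂ (≮⇒≡top a′<d a′+1≮d , sym (∷ʳ-injectiveʳ (P ∷ʳ 0) A e₀))

  left-lifted : ∀ p Y A a → All (_< d) Y → Φ Y ≡ A ++ a ∷ topIf p →
    ∃₂ λ Y′ a′ → Y ≡ Y′ ∷ʳ a′ × Lifted p a a′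
  left-lifted p [] []      a _ ()
  left-lifted p [] (_ ∷ _) a _ ()
  left-lifted p (y ∷ Y) A a Y<d e with ∷-unsnoc y Y
  ... | Y′ , a′ , e′ = Y′ , a′ , e′ ,
    φ-end-lifted p a′ (Φ Y′) A (last-letter (subst (All (_< d)) e′ Y<d))
      (trans (sym (Φ-∷ʳ Y′ a′)) (trans (cong Φ (sym e′)) e))
    where
    last-letter : All (_< d) (Y′ ∷ʳ a′) → a′ < d
    last-letter h with ++⁻ʳ Y′ h
    ... | a′<d All.∷ _ = a′<d

  wrap-occurrence : ∀ as a p v t b bs →
    as ++ (a ∷ wrap p v t ++ b ∷ []) ++ bs ≡ (as ++ a ∷ topIf p) ++ Φ v ++ 0 ∷ topIf t ++ b ∷ bs
  wrap-occurrence as a p v t b bs = regroup as (a ∷ []) (topIf p) (Φ v) (0 ∷ []) (topIf t) (b ∷ []) bs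
    where
    regroup : ∀ (as x P V z T y bs : List ℕ) →
      as ++ (x ++ (P ++ V ++ z ++ T) ++ y) ++ bs ≡ (as ++ x ++ P) ++ V ++ z ++ T ++ y ++ bs
    regroup as x P V z T y bs = solve (++-monoid ℕ)

  Φ-desubstitute : ∀ p t v Y {a b} as bs → All (_< d) v → All (_< d) Y →
    Φ Y ≡ as ++ (a ∷ wrap p v t ++ b ∷ []) ++ bs →
    ∃₂ λ a′ b′ → Infix (a′ ∷ v ++ b′ ∷ []) Y × Lifted p a a′ × Lifted t b b′
  Φ-desubstitute p t v Y {a} {b} as bs v<d Y<d e with Φ-++-0∷ v (topIf t ++ b ∷ bs)
  ... | R , eR with Φ-cut-at-0 Y (as ++ a ∷ topIf p) R
                      (trans e (trans (wrap-occurrence as a p v t b bs) (cong ((as ++ a ∷ topIf p) ++_) eR)))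
  ...   | Y₁ , Y₂ , refl , eY₁ , eY₂ with Φ-cancel-prefix v Y₂ _ v<d (++⁻ʳ Y₁ Y<d) (trans eY₂ (sym eR))
  ...     | Y₃ , refl , eY₃ with right-lifted t Y₃ b bs (++⁻ʳ v (++⁻ʳ Y₁ Y<d)) eY₃
  ...       | b′ , Y₄ , refl , lb with left-lifted p Y₁ as a (++⁻ˡ Y₁ Y<d) eY₁
  ...         | Y₀ , a′ , refl , la = a′ , b′ , (Y₀ , Y₄ , reassoc Y₀ (a′ ∷ []) v (b′ ∷ []) Y₄) , la , lb
    where
    reassoc : ∀ (as x v y bs : List ℕ) → (as ++ x) ++ v ++ y ++ bs ≡ as ++ (x ++ v ++ y) ++ bs
    reassoc as x v y bs = solve (++-monoid ℕ)

  opaque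
    unfolding Fac

    desubstitute : ∀ p t v {a b} → All (_< d) v → Fac (a ∷ wrap p v t ++ b ∷ []) →
      ∃₂ λ a′ b′ → Fac (a′ ∷ v ++ b′ ∷ []) × Lifted p a a′ × Lifted t b b′
    desubstitute p t v v<d (K , occ) with infix-X-suc K occ
    ... | as , bs , e with Φ-desubstitute p t v (X K) as bs v<d (X-letters K) e
    ...   | a′ , b′ , occ′ , la , lb = a′ , b′ , (K , occ′) , la , lb

  -- Extensions of F_k

  Lft : List ℕ → ℕ → Set
  Lft w a = Fac (a ∷ w)

  Rgt : List ℕ → ℕ → Set
  Rgt w b = Fac (w ++ b ∷ [])

  Ext : List ℕ → ℕ → ℕ → Set
  Ext w a b = Fac (a ∷ w ++ b ∷ [])

  Ext⇒Lft : ∀ {w a b} → Ext w a b → Lft w a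
  Ext⇒Lft {w} {a} {b} = Fac-infix (infix-prefix (a ∷ w) (b ∷ []))

  Ext⇒Rgt : ∀ {w a b} → Ext w a b → Rgt w b
  Ext⇒Rgt {w} {a} {b} = Fac-infix (infix-suffix (a ∷ []) (w ++ b ∷ []))

  Ext-head : ∀ {w a b} → Ext w a b → a < d
  Ext-head ext with Fac-letters ext
  ... | a<d All.∷ _ = a<d

  Ext-last : ∀ {w a b} → Ext w a b → b < d
  Ext-last {w} {a} ext with ++⁻ʳ (a ∷ w) (Fac-letters ext)
  ... | b<d All.∷ _ = b<d

  Ext-inner : ∀ {w a b} → Ext w a b → All (_< d) w
  Ext-inner {w} ext with Fac-letters ext
  ... | _ All.∷ h = ++⁻ˡ w h

  Ext-φ : ∀ {v a b} → Ext v a b → Ext (wrap false v false) (ψ a) (ψ b)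
  Ext-φ {v} {a} {b} ext with φ-last a | φ-first b
  ... | pre , ea | post , eb = Fac-infix (pre , post ++ [] , (begin
    φ d a ++ Φ (v ++ b ∷ [])                          ≡⟨ cong₂ _++_ ea (Φ-++ v (b ∷ [])) ⟩
    (pre ∷ʳ ψ a) ++ Φ v ++ φ d b ++ []               ≡⟨ cong (λ z → (pre ∷ʳ ψ a) ++ Φ v ++ z ++ []) eb ⟩
    (pre ∷ʳ ψ a) ++ Φ v ++ (0 ∷ ψ b ∷ post) ++ []
      ≡⟨ regroup pre (ψ a ∷ []) (Φ v) (0 ∷ []) (ψ b ∷ []) post ⟩
    pre ++ (ψ a ∷ (Φ v ++ 0 ∷ []) ++ ψ b ∷ []) ++ post ++ [] ∎)) (Fac-Φ ext)
    where
    open ≡-Reasoning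
    regroup : ∀ (P x V z y Q : List ℕ) →
      (P ++ x) ++ V ++ (z ++ y ++ Q) ++ [] ≡ P ++ (x ++ (V ++ z) ++ y) ++ Q ++ []
    regroup P x V z y Q = solve (++-monoid ℕ)

  Fac-letter : ∀ j → j ≤ top → Fac (j ∷ [])
  Fac-letter zero    _      = Fac-X 0
  Fac-letter (suc j) j+1≤top =
    Fac-infix (0 ∷ [] , [] , cong (_++ []) (φ-short (s≤s j+1≤top))) (Fac-Φ (Fac-letter j (<⇒≤ j+1≤top)))

  F-ext-up : ∀ k → k < top → Ext (F d k) k (suc k)
  F-ext-up zero    _        = subst Fac X-1 (Fac-X 1)
  F-ext-up (suc k) k+1<top =
    subst₂ (Ext (F d (suc k))) (ψ-short (<-trans k+1<top ≤-refl)) (ψ-short (s≤s k+1<top))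
      (Ext-φ (F-ext-up k (<-trans (n<1+n k) k+1<top)))

  F-ext-down : ∀ k → k < top → Ext (F d k) (suc k) k
  F-ext-down zero    _        = Fac-infix (0 ∷ [] , 2 ∷ [] , X-2) (Fac-X 2)
  F-ext-down (suc k) k+1<top =
    subst₂ (Ext (F d (suc k))) (ψ-short (s≤s k+1<top)) (ψ-short (<-trans k+1<top ≤-refl))
      (Ext-φ (F-ext-down k (<-trans (n<1+n k) k+1<top)))

  F-ext-top : ∀ k → Ext (F d k) top top
  F-ext-top zero    =
    Fac-infix (0 ∷ [] , [] , cong (_++ []) (φ-long (<-irrefl refl))) (Fac-Φ (Fac-letter top ≤-refl))
  F-ext-top (suc k) = subst₂ (Ext (F d (suc k))) ψ-top ψ-top (Ext-φ (F-ext-top k))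

  F-letters : ∀ k → All (_< d) (F d k)
  F-letters k = Ext-inner (F-ext-top k)

  <-ψ : ∀ {k b} → suc k < top → k < b → b < d → suc k < ψ b
  <-ψ {k} {b} k+1<top k<b b<d with shape b
  ... | short _ _ ψb = subst (suc k <_) (sym ψb) (s≤s k<b)
  ... | long  _ _ ψb = subst (suc k <_) (sym ψb) k+1<top

  FPair-ψ : ∀ {k a b} → suc k < top → a < d → b < d → FPair k a b → FPair (suc k) (ψ a) (ψ b)
  FPair-ψ k+1<top a<d b<d (inj₁ (refl , k<b)) =
    inj₁ (ψ-short (<-trans k+1<top ≤-refl) , <-ψ k+1<top k<b b<d)
  FPair-ψ k+1<top a<d b<d (inj₂ (inj₁ (k<a , refl))) =
    inj₂ (inj₁ (<-ψ k+1<top k<a a<d , ψ-short (<-trans k+1<top ≤-refl)))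
  FPair-ψ k+1<top a<d b<d (inj₂ (inj₂ (refl , refl))) = inj₂ (inj₂ (ψ-top , ψ-top))

  F-exts : ∀ k {a b} → k < top → Ext (F d k) a b → FPair k a b
  F-exts zero    _        ext = Fac-pair ext
  F-exts (suc k) k+1<top ext =
    let a′ , b′ , ext′ , a≡ψa′ , b≡ψb′ = desubstitute false false (F d k) (F-letters k) ext
    in subst₂ (FPair (suc k)) (sym a≡ψa′) (sym b≡ψb′)
         (FPair-ψ k+1<top (Ext-head ext′) (Ext-last ext′) (F-exts k (<-trans (n<1+n k) k+1<top) ext′))

  FPair-sym : ∀ {k a b} → FPair k a b → FPair k b a
  FPair-sym (inj₁ (a≡k , k<b))         = inj₂ (inj₁ (k<b , a≡k))
  FPair-sym (inj₂ (inj₁ (k<a , b≡k)))  = inj₁ (b≡k , k<a)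
  FPair-sym (inj₂ (inj₂ (a≡top , b≡top))) = inj₂ (inj₂ (b≡top , a≡top))

  FPair-high : ∀ {k a b} → suc m ≤ b → FPair k a b → a ≡ k ⊎ suc m ≤ a
  FPair-high _    (inj₁ (a≡k , _))          = inj₁ a≡k
  FPair-high m<b (inj₂ (inj₁ (k<a , refl)))  = inj₂ (≤-trans m<b (<⇒≤ k<a))
  FPair-high _    (inj₂ (inj₂ (refl , _)))   = inj₂ (n≤1+n _)

  FPair-last : ∀ {a b} → a < d → FPair (suc m) a b → a ≡ suc m ⊎ a ≡ top
  FPair-last a<d (inj₁ (a≡m+1 , _))       = inj₁ a≡m+1
  FPair-last a<d (inj₂ (inj₁ (m+1<a , _))) = inj₂ (≤-antisym (s≤s⁻¹ a<d) m+1<a)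
  FPair-last a<d (inj₂ (inj₂ (a≡top , _))) = inj₂ a≡top

  -- Bispecial factors

  Bisp : List ℕ → Set
  Bisp w = Two (Lft w) × Two (Rgt w)

  Lft-desubstitute : ∀ p t v {a} → All (_< d) v → Lft (wrap p v t) a →
    ∃₂ λ a′ b′ → Ext v a′ b′ × Lifted p a a′ × ∃ λ b → Lifted t b b′
  Lft-desubstitute p t v v<d l =
    let b , ext = Fac-right l
        a′ , b′ , ext′ , la , lb = desubstitute p t v v<d ext
    in a′ , b′ , ext′ , la , b , lb

  Rgt-desubstitute : ∀ p t v {b} → All (_< d) v → Rgt (wrap p v t) b →
    ∃₂ λ a′ b′ → Ext v a′ b′ × (∃ λ a → Lifted p a a′) × Lifted t b b′
  Rgt-desubstitute p t v v<d r =
    let a , ext = Fac-left r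
        a′ , b′ , ext′ , la , lb = desubstitute p t v v<d ext
    in a′ , b′ , ext′ , (a , la) , lb

  Lifted-functional : ∀ p {a₁ a₂ a₁′ a₂′} → Lifted p a₁ a₁′ → Lifted p a₂ a₂′ → a₁′ ≡ a₂′ →
    a₁ ≡ a₂
  Lifted-functional false a₁≡ψ a₂≡ψ refl = trans a₁≡ψ (sym a₂≡ψ)
  Lifted-functional true (inj₁ (_ , a₁≡0))   (inj₁ (_ , a₂≡0))   refl = trans a₁≡0 (sym a₂≡0)
  Lifted-functional true (inj₁ (refl , _))   (inj₂ (() , _))     refl
  Lifted-functional true (inj₂ (refl , _))   (inj₁ (() , _))     refl
  Lifted-functional true (inj₂ (_ , a₁≡top)) (inj₂ (_ , a₂≡top)) refl = trans a₁≡top (sym a₂≡top)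

  Lifted-true : ∀ {a a′} → Lifted true a a′ → a ≡ 0 ⊎ a ≡ top
  Lifted-true (inj₁ (_ , a≡0))   = inj₁ a≡0
  Lifted-true (inj₂ (_ , a≡top)) = inj₂ a≡top

  Lifted-true-high : ∀ {a a′} → Lifted true a a′ → suc m ≤ a′
  Lifted-true-high (inj₁ (refl , _)) = ≤-refl
  Lifted-true-high (inj₂ (refl , _)) = n≤1+n _

  Bisp-desubstitute : ∀ p t v → All (_< d) v → Bisp (wrap p v t) → Bisp v
  Bisp-desubstitute p t v v<d ((a₁ , a₂ , a₁≢a₂ , l₁ , l₂) , (b₁ , b₂ , b₁≢b₂ , r₁ , r₂)) =
    let a₁′ , _ , ext₁ , la₁ , _ = Lft-desubstitute p t v v<d l₁
        a₂′ , _ , ext₂ , la₂ , _ = Lft-desubstitute p t v v<d l₂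
        _ , b₁′ , ext₃ , _ , lb₁ = Rgt-desubstitute p t v v<d r₁
        _ , b₂′ , ext₄ , _ , lb₂ = Rgt-desubstitute p t v v<d r₂
    in (a₁′ , a₂′ , a₁≢a₂ ∘ Lifted-functional p la₁ la₂ , Ext⇒Lft ext₁ , Ext⇒Lft ext₂) ,
       (b₁′ , b₂′ , b₁≢b₂ ∘ Lifted-functional t lb₁ lb₂ , Ext⇒Rgt ext₃ , Ext⇒Rgt ext₄)

  TopOr : (ℕ → Set) → Set
  TopOr P = ∃ λ x → ∀ a → P a → a ≡ x ⊎ a ≡ top

  TopOrBoth : List ℕ → Set
  TopOrBoth w = TopOr (Lft w) × TopOr (Rgt w)

  TopOr-Two⇒top : ∀ {P} → TopOr P → Two P → P top
  TopOr-Two⇒top (x , only) (a , b , a≢b , pa , pb) with only a pa | only b pb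
  ... | inj₂ refl | _         = pa
  ... | inj₁ _    | inj₂ refl = pb
  ... | inj₁ a≡x  | inj₁ b≡x  = contradiction (trans a≡x (sym b≡x)) a≢b

  TopOr⇒¬Three : ∀ {P} → TopOr P → ¬ Three P
  TopOr⇒¬Three (x , only) (a , b , c , a≢b , a≢c , b≢c , pa , pb , pc) with only a pa | only b pb | only c pc
  ... | inj₁ a≡x   | inj₁ b≡x   | _          = a≢b (trans a≡x (sym b≡x))
  ... | inj₂ a≡top | inj₂ b≡top | _          = a≢b (trans a≡top (sym b≡top))
  ... | inj₁ a≡x   | _          | inj₁ c≡x   = a≢c (trans a≡x (sym c≡x))
  ... | inj₂ a≡top | _          | inj₂ c≡top = a≢c (trans a≡top (sym c≡top))
  ... | _          | inj₁ b≡x   | inj₁ c≡x   = b≢c (trans b≡x (sym c≡x))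
  ... | _          | inj₂ b≡top | inj₂ c≡top = b≢c (trans b≡top (sym c≡top))

  ψ-TopOr : ∀ {x a a′} → a′ < d → a ≡ ψ a′ → a′ ≡ x ⊎ suc m ≤ a′ → a ≡ ψ x ⊎ a ≡ top
  ψ-TopOr _    a≡ψa′ (inj₁ refl) = inj₁ a≡ψa′
  ψ-TopOr a′<d a≡ψa′ (inj₂ m<a′) = inj₂ (trans a≡ψa′ (ψ-high m<a′ a′<d))

  ≡top⇒high : ∀ {x a} → a ≡ x ⊎ a ≡ top → a ≡ x ⊎ suc m ≤ a
  ≡top⇒high (inj₁ a≡x) = inj₁ a≡x
  ≡top⇒high (inj₂ refl) = inj₂ (n≤1+n _)

  wrap-true-left : ∀ t v → All (_< d) v → TopOr (Lft (wrap true v t))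
  wrap-true-left t v v<d = 0 , only
    where
    only : ∀ a → Lft (wrap true v t) a → a ≡ 0 ⊎ a ≡ top
    only a l = let _ , _ , _ , la , _ = Lft-desubstitute true t v v<d l in Lifted-true la

  wrap-true-right : ∀ p v → All (_< d) v → TopOr (Rgt (wrap p v true))
  wrap-true-right p v v<d = 0 , only
    where
    only : ∀ b → Rgt (wrap p v true) b → b ≡ 0 ⊎ b ≡ top
    only b r = let _ , _ , _ , _ , lb = Rgt-desubstitute p true v v<d r in Lifted-true lb

  wrap-false-left : ∀ t v → All (_< d) v → TopOr (Lft v) → TopOr (Lft (wrap false v t))
  wrap-false-left t v v<d (x , only-x) = ψ x , only
    where
    only : ∀ a → Lft (wrap false v t) a → a ≡ ψ x ⊎ a ≡ top
    only a l =
      let a′ , _ , ext , la , _ = Lft-desubstitute false t v v<d l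
      in ψ-TopOr (Ext-head ext) la (≡top⇒high (only-x a′ (Ext⇒Lft ext)))

  wrap-false-right : ∀ p v → All (_< d) v → TopOr (Rgt v) → TopOr (Rgt (wrap p v false))
  wrap-false-right p v v<d (y , only-y) = ψ y , only
    where
    only : ∀ b → Rgt (wrap p v false) b → b ≡ ψ y ⊎ b ≡ top
    only b r =
      let _ , b′ , ext , _ , lb = Rgt-desubstitute p false v v<d r
      in ψ-TopOr (Ext-last ext) lb (≡top⇒high (only-y b′ (Ext⇒Rgt ext)))

  wrap-TopOrBoth : ∀ p t v → All (_< d) v → TopOrBoth v → TopOrBoth (wrap p v t)
  wrap-TopOrBoth p t v v<d (tl , tr) = left p , right t
    where
    left : ∀ p → TopOr (Lft (wrap p v t))
    left false = wrap-false-left t v v<d tl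
    left true  = wrap-true-left t v v<d
    right : ∀ t → TopOr (Rgt (wrap p v t))
    right false = wrap-false-right p v v<d tr
    right true  = wrap-true-right p v v<d

  ≤m⇒<top : ∀ {k} → k ≤ m → k < top
  ≤m⇒<top k≤m = s≤s (m≤n⇒m≤1+n k≤m)

  -- The right partner b′ of a′ is ≥ d - 2 since φ(b′) starts with 0 top; so a′ = k or ψ a′ = top.
  wrapF-left : ∀ k → k ≤ m → TopOr (Lft (wrap false (F d k) true))
  wrapF-left k k≤m = ψ k , only
    where
    only : ∀ a → Lft (wrap false (F d k) true) a → a ≡ ψ k ⊎ a ≡ top
    only a l =
      let _ , _ , ext , la , _ , lb = Lft-desubstitute false true (F d k) (F-letters k) l
      in ψ-TopOr (Ext-head ext) la (FPair-high (Lifted-true-high lb) (F-exts k (≤m⇒<top k≤m) ext))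

  wrapF-right : ∀ k → k ≤ m → TopOr (Rgt (wrap true (F d k) false))
  wrapF-right k k≤m = ψ k , only
    where
    only : ∀ b → Rgt (wrap true (F d k) false) b → b ≡ ψ k ⊎ b ≡ top
    only b r =
      let _ , _ , ext , (_ , la) , lb = Rgt-desubstitute true false (F d k) (F-letters k) r
      in ψ-TopOr (Ext-last ext) lb (FPair-high (Lifted-true-high la) (FPair-sym (F-exts k (≤m⇒<top k≤m) ext)))

  F-last-TopOrBoth : TopOrBoth (F d (suc m))
  F-last-TopOrBoth = (suc m , left) , (suc m , right)
    where
    left : ∀ a → Lft (F d (suc m)) a → a ≡ suc m ⊎ a ≡ top
    left a l = let _ , ext = Fac-right l in FPair-last (Ext-head ext) (F-exts (suc m) ≤-refl ext)
    right : ∀ b → Rgt (F d (suc m)) b → b ≡ suc m ⊎ b ≡ top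
    right b r = let _ , ext = Fac-left r in FPair-last (Ext-last ext) (FPair-sym (F-exts (suc m) ≤-refl ext))

  top-TopOrBoth : TopOrBoth (top ∷ [])
  top-TopOrBoth = (0 , left) , (0 , right)
    where
    left : ∀ a → Lft (top ∷ []) a → a ≡ 0 ⊎ a ≡ top
    left a l with Fac-pair l
    ... | inj₁ (a≡0 , _)          = inj₁ a≡0
    ... | inj₂ (inj₁ (_ , ()))
    ... | inj₂ (inj₂ (a≡top , _)) = inj₂ a≡top
    right : ∀ b → Rgt (top ∷ []) b → b ≡ 0 ⊎ b ≡ top
    right b r with Fac-pair r
    ... | inj₁ (() , _)
    ... | inj₂ (inj₁ (_ , b≡0))   = inj₁ b≡0
    ... | inj₂ (inj₂ (_ , b≡top)) = inj₂ b≡top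

  left-special-shape : ∀ w → Two (Lft w) → w ≡ [] ⊎ w ≡ top ∷ [] ⊎ ∃₂ λ p w′ → w ≡ topIf p ++ 0 ∷ w′
  left-special-shape [] _ = inj₁ refl
  left-special-shape (c ∷ w) two with c ≟ 0 | c ≟ top
  ... | yes refl | _ = inj₂ (inj₂ (false , w , refl))
  ... | no c≢0 | no c≢top = contradiction two (¬Two-unique 0 only-0)
    where
    only-0 : ∀ a → Lft (c ∷ w) a → a ≡ 0
    only-0 a l with Fac-pair (Fac-infix (infix-prefix (a ∷ c ∷ []) w) l)
    ... | inj₁ (a≡0 , _)          = a≡0
    ... | inj₂ (inj₁ (_ , c≡0))   = contradiction c≡0 c≢0
    ... | inj₂ (inj₂ (_ , c≡top)) = contradiction c≡top c≢top
  left-special-shape (c ∷ []) two | no _ | yes refl = inj₂ (inj₁ refl)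
  left-special-shape (c ∷ c′ ∷ w) two@(a , _ , _ , l , _) | no _ | yes refl
    with Fac-pair (Fac-infix (infix-middle (a ∷ []) (top ∷ c′ ∷ []) w) l)
  ... | inj₁ (() , _)
  ... | inj₂ (inj₁ (_ , refl)) = inj₂ (inj₂ (true , w , refl))
  ... | inj₂ (inj₂ (_ , refl)) = contradiction two (¬Two-unique 0 only-0)
    where
    only-0 : ∀ a → Lft (top ∷ top ∷ w) a → a ≡ 0
    only-0 a l with Fac-triple (Fac-infix (infix-prefix (a ∷ top ∷ top ∷ []) w) l)
    ... | inj₁ a≡0 = a≡0
    ... | inj₂ (inj₁ ())
    ... | inj₂ (inj₂ ())

  Rgt-suffix : ∀ P S T {b} → Rgt (P ++ S ++ T) b → Fac (T ++ b ∷ [])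
  Rgt-suffix P S T {b} = Fac-infix (P ++ S , [] , regroup P S T (b ∷ []))
    where
    regroup : ∀ (P S T B : List ℕ) → (P ++ S ++ T) ++ B ≡ (P ++ S) ++ (T ++ B) ++ []
    regroup P S T B = solve (++-monoid ℕ)

  right-special-end : ∀ P w → Two (Rgt (P ++ 0 ∷ w)) → ∃₂ λ t s → 0 ∷ w ≡ s ++ 0 ∷ topIf t
  right-special-end P w two@(b , _ , _ , r , _) = ends (∷-unsnoc 0 w)
    where
    ext-of : ∀ S T → 0 ∷ w ≡ S ++ T → ∀ {b} → Rgt (P ++ 0 ∷ w) b → Fac (T ++ b ∷ [])
    ext-of S T eq r = Rgt-suffix P S T (subst (λ z → Rgt (P ++ z) _) eq r)

    ends-top₂ : ∀ S e → 0 ∷ w ≡ S ++ e ∷ top ∷ [] → ∃₂ λ t s → 0 ∷ w ≡ s ++ 0 ∷ topIf t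
    ends-top₂ S e eq
      with Fac-pair (Fac-infix (infix-prefix (e ∷ top ∷ []) (b ∷ [])) (ext-of S (e ∷ top ∷ []) eq r))
    ... | inj₁ (refl , _)        = true , S , eq
    ... | inj₂ (inj₁ (_ , ()))
    ... | inj₂ (inj₂ (refl , _)) = contradiction two (¬Two-unique 0 only-0)
      where
      only-0 : ∀ b → Rgt (P ++ 0 ∷ w) b → b ≡ 0
      only-0 b r with Fac-triple (ext-of S (top ∷ top ∷ []) eq r)
      ... | inj₁ ()
      ... | inj₂ (inj₁ ())
      ... | inj₂ (inj₂ b≡0) = b≡0

    ends-top : ∀ S → 0 ∷ w ≡ S ∷ʳ top → ∃₂ λ t s → 0 ∷ w ≡ s ++ 0 ∷ topIf t
    ends-top []      eq = contradiction (∷-injectiveˡ eq) λ ()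
    ends-top (x ∷ S) eq =
      let S′ , e , eq′ = ∷-unsnoc x S
      in ends-top₂ S′ e (trans eq (trans (cong (_∷ʳ top) eq′) (∷ʳ-++ S′ e (top ∷ []))))

    ends : (∃₂ λ S e → 0 ∷ w ≡ S ∷ʳ e) → ∃₂ λ t s → 0 ∷ w ≡ s ++ 0 ∷ topIf t
    ends (S , e , eq) with e ≟ 0 | e ≟ top
    ... | yes refl | _        = false , S , eq
    ... | no _     | yes refl = ends-top S eq
    ... | no e≢0   | no e≢top = contradiction two (¬Two-unique 0 only-0)
      where
      only-0 : ∀ b → Rgt (P ++ 0 ∷ w) b → b ≡ 0
      only-0 b r with Fac-pair (ext-of S (e ∷ []) eq r)
      ... | inj₁ (e≡0 , _)          = contradiction e≡0 e≢0
      ... | inj₂ (inj₁ (_ , b≡0))   = b≡0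
      ... | inj₂ (inj₂ (e≡top , _)) = contradiction e≡top e≢top

  opaque
    unfolding Fac

    Φ-preimage : ∀ s → Fac (0 ∷ s ++ 0 ∷ []) → ∃ λ v → 0 ∷ s ≡ Φ v × Fac v
    Φ-preimage s (K , occ) with infix-X-suc K occ
    ... | as , bs , e with Φ-cut-at-0 (X K) as ((s ++ 0 ∷ []) ++ bs) e
    ...   | Y₁ , Y₂ , e₁ , _ , eY₂
      with Φ-cut-at-0 Y₂ (0 ∷ s) bs (trans eY₂ (cong (0 ∷_) (++-assoc s (0 ∷ []) bs)))
    ...     | V , Y₃ , e₂ , eV , _ = V , sym eV , K , Y₁ , Y₃ , trans e₁ (cong (Y₁ ++_) e₂)

  core-preimage : ∀ P w s T → Fac (P ++ 0 ∷ w) → 0 ∷ w ≡ s ++ 0 ∷ T → ∃ λ v → s ≡ Φ v × Fac v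
  core-preimage P w []      T _ _ = [] , refl , Fac-infix (infix-prefix [] (X 0)) (Fac-X 0)
  core-preimage P w (x ∷ s) T f e with ∷-injectiveˡ e
  ... | refl =
    Φ-preimage s (Fac-infix (P , T , cong (P ++_) (trans e (cong (0 ∷_) (sym (++-assoc s (0 ∷ []) T))))) f)

  bispecial-shape : ∀ w → Bisp w → w ≡ [] ⊎ w ≡ top ∷ [] ⊎ ∃₂ λ p t → ∃ λ v → w ≡ wrap p v t × Fac v
  bispecial-shape w (two-l@(a , _ , _ , l , _) , two-r) with left-special-shape w two-l
  ... | inj₁ w≡[]    = inj₁ w≡[]
  ... | inj₂ (inj₁ w≡top) = inj₂ (inj₁ w≡top)
  ... | inj₂ (inj₂ (p , w′ , refl)) with right-special-end (topIf p) w′ two-r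
  ...   | t , s , e with core-preimage (topIf p) w′ s (topIf t) (Fac-infix (infix-suffix (a ∷ []) _) l) e
  ...     | v , refl , fv = inj₂ (inj₂ (p , t , v , cong (topIf p ++_) e , fv))

  length-<-wrap : ∀ p v t → length v < length (wrap p v t)
  length-<-wrap p v t = begin-strict
    length v                          ≤⟨ length-≤-Φ v ⟩
    length (Φ v)                      ≤⟨ length-++-≤ˡ (Φ v) ⟩
    length (Φ v ++ topIf t)           <⟨ n<1+n _ ⟩
    suc (length (Φ v ++ topIf t))     ≡⟨ length-++-sucʳ (Φ v) 0 (topIf t) ⟨
    length (Φ v ++ 0 ∷ topIf t)       ≤⟨ length-++-≤ʳ _ {topIf p} ⟩
    length (wrap p v t)               ∎
    where open ≤-Reasoning

  Classified : List ℕ → Set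
  Classified w = (∃ λ k → k ≤ m × w ≡ F d k) ⊎ TopOrBoth w

  wrapF-classified : ∀ k → k ≤ m → ∀ p t → Classified (wrap p (F d k) t)
  wrapF-classified k k≤m false false with k <? m
  ... | yes k<m = inj₁ (suc k , k<m , refl)
  ... | no  k≮m rewrite ≤-antisym k≤m (≮⇒≥ k≮m) = inj₂ F-last-TopOrBoth
  wrapF-classified k k≤m false true  = inj₂ (wrapF-left k k≤m , wrap-true-right false (F d k) (F-letters k))
  wrapF-classified k k≤m true  false = inj₂ (wrap-true-left false (F d k) (F-letters k) , wrapF-right k k≤m)
  wrapF-classified k k≤m true  true  =
    inj₂ (wrap-true-left true (F d k) (F-letters k) , wrap-true-right true (F d k) (F-letters k))

  classify-acc : ∀ w → Acc _<_ (length w) → Bisp w → Classified w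
  classify-acc w (acc rs) bisp with bispecial-shape w bisp
  ... | inj₁ refl       = inj₁ (0 , z≤n , refl)
  ... | inj₂ (inj₁ refl) = inj₂ top-TopOrBoth
  ... | inj₂ (inj₂ (p , t , v , refl , fv))
    with classify-acc v (rs (length-<-wrap p v t)) (Bisp-desubstitute p t v (Fac-letters fv) bisp)
  ...   | inj₁ (k , k≤m , refl) = wrapF-classified k k≤m p t
  ...   | inj₂ both          = inj₂ (wrap-TopOrBoth p t v (Fac-letters fv) both)

  Bispecial⇒Bisp : ∀ {w} → Bispecial d w → Bisp w
  Bispecial⇒Bisp (two-l , two-r) = Two-map Factor⇒Fac two-l , Two-map Factor⇒Fac two-r

  classify : ∀ w → Bispecial d w → Classified w
  classify w bisp = classify-acc w (<-wellFounded (length w)) (Bispecial⇒Bisp bisp)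

  bispecial⇒top-extensions : ∀ w → Bispecial d w → LeftExt d w top × RightExt d w top
  bispecial⇒top-extensions w bisp with classify w bisp
  ... | inj₁ (k , _ , refl) = Fac⇒Factor (Ext⇒Lft (F-ext-top k)) , Fac⇒Factor (Ext⇒Rgt (F-ext-top k))
  ... | inj₂ (tl , tr) =
    let two-l , two-r = Bispecial⇒Bisp bisp
    in Fac⇒Factor (TopOr-Two⇒top tl two-l) , Fac⇒Factor (TopOr-Two⇒top tr two-r)

  rich-bispecial⇒F : ∀ w → Bispecial d w × (ThreeLeft d w ⊎ ThreeRight d w) →
    ∃ λ k → k ≤ m × w ≡ F d k
  rich-bispecial⇒F w (bisp , three) with classify w bisp | three
  ... | inj₁ isF       | _         = isF
  ... | inj₂ (tl , _)  | inj₁ left  = contradiction (Three-map Factor⇒Fac left) (TopOr⇒¬Three tl)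
  ... | inj₂ (_ , tr)  | inj₂ right = contradiction (Three-map Factor⇒Fac right) (TopOr⇒¬Three tr)

  F⇒rich-bispecial : ∀ w → (∃ λ k → k ≤ m × w ≡ F d k) →
    Bispecial d w × (ThreeLeft d w ⊎ ThreeRight d w)
  F⇒rich-bispecial w (k , k≤m , refl) =
    ((k , top , k≢top , lk , ltop) , (suc k , k , 1+n≢n , Fac⇒Factor (Ext⇒Rgt up) , Fac⇒Factor (Ext⇒Rgt down))) ,
    inj₁ (k , suc k , top , 1+n≢n ∘ sym , k≢top , k+1≢top , lk , Fac⇒Factor (Ext⇒Lft down) , ltop)
    where
    up : Ext (F d k) k (suc k)
    up = F-ext-up k (≤m⇒<top k≤m)
    down : Ext (F d k) (suc k) k
    down = F-ext-down k (≤m⇒<top k≤m)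
    lk : LeftExt d (F d k) k
    lk = Fac⇒Factor (Ext⇒Lft up)
    ltop : LeftExt d (F d k) top
    ltop = Fac⇒Factor (Ext⇒Lft (F-ext-top k))
    k≢top : ¬ k ≡ top
    k≢top k≡top = <-irrefl k≡top (≤m⇒<top k≤m)
    k+1≢top : ¬ suc k ≡ top
    k+1≢top k+1≡top = <-irrefl k+1≡top (s≤s (s≤s k≤m))

corollary5 : (d : ℕ) → 3 ≤ d →
    ((w : List ℕ) → Bispecial d w → LeftExt d w (d ∸ 1) × RightExt d w (d ∸ 1))
    × ((w : List ℕ) →
        (Bispecial d w × (ThreeLeft d w ⊎ ThreeRight d w))
        ⇔ Σ ℕ (λ k → k ≤ d ∸ 3 × w ≡ F d k))
corollary5 (suc (suc (suc m))) (s≤s (s≤s (s≤s z≤n))) =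
  bispecial⇒top-extensions , λ w → mk⇔ (rich-bispecial⇒F w) (F⇒rich-bispecial w)
  where open FixedPoint m
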